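{- The set of cardioidal starters (taken over all admissible orders $n$) is a nonempty proper subset of the set of Skolem starters.
   Context: For odd $n\ge3$, a starter in $\mathbb{Z}_n$ is a partition of $\mathbb{Z}_n\setminus\{0\}$ into $(n-1)/2$ pairs $\{s_i,t_i\}$ such that the elements $\pm(s_i-t_i)$ are exactly the non-zero elements of $\mathbb{Z}_n$. With $q=(n-1)/2$ and non-zero residues ordered $1<2<\dots<2q$, a starter is Skolem if it can be written as $\{\{s_i,t_i\}\}_{i=1}^q$ with $t_i-s_i\equiv i\pmod n$ and $t_i>s_i$. A cardioidal pair in $\mathbb{Z}_n$ is a pair $\{i,2i\bmod n\}$ with $i\in\mathbb{Z}_n\setminus\{0\}$; a starter of order $n$ is cardioidal if all its pairs are cardioidal pairs. -}

module Defs where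

open import Data.Nat using (ℕ; zero; suc; _+_; _*_; _∸_; _≤_; _<_; _⊓_; _⊔_)
open import Data.Nat.DivMod using (_%_)
open import Data.Fin using (Fin; toℕ)
open import Data.List using (List; []; _∷_; map; upTo; concatMap; tabulate)
open import Data.List.Relation.Unary.All using (All)
open import Data.List.Relation.Binary.Permutation.Propositional using (_↭_)
open import Data.Product using (_×_; _,_; ∃; Σ)
open import Data.Sum using (_⊎_)
open import Relation.Binary.PropositionalEquality using (_≡_)

-- Residues of ℤ_n are represented by their canonical representatives 0,…,n-1 in ℕ.
-- x mod n (for n = 0 we just return x; only used with odd n ≥ 3).
_mod_ : ℕ → ℕ → ℕ
x mod zero = x
x mod (suc m) = x % suc m

Odd : ℕ → Set
Odd n = n mod 2 ≡ 1

half : ℕ → ℕ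
half n = Data.Nat._/_ (n ∸ 1) 2

nonZeroResidues : ℕ → List ℕ
nonZeroResidues n = map suc (upTo (n ∸ 1))

-- a (candidate) starter: a list of (unordered) pairs {s,t}, written as s , t
Pairs : Set
Pairs = List (ℕ × ℕ)

elems : Pairs → List ℕ
elems = concatMap (λ { (s , t) → s ∷ t ∷ [] })

diffs : ℕ → Pairs → List ℕ
diffs n = concatMap (λ { (s , t) → ((s + n ∸ t) mod n) ∷ ((t + n ∸ s) mod n) ∷ [] })

IsStarter : ℕ → Pairs → Set
IsStarter n S = Odd n × 3 ≤ n × (elems S ↭ nonZeroResidues n) × (diffs n S ↭ nonZeroResidues n)

norm : ℕ × ℕ → ℕ × ℕ
norm (a , b) = (a ⊓ b , a ⊔ b)

-- S can be written as {{s_i,t_i}}_{i=1..q} with t_i - s_i ≡ i (mod n) and t_i > s_i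
-- (index i = toℕ k + 1 for k : Fin q).
IsSkolem : ℕ → Pairs → Set
IsSkolem n S = Σ (Fin (half n) → ℕ × ℕ) λ f →
  (map norm S ↭ map norm (tabulate f)) ×
  ((k : Fin (half n)) → let (s , t) = f k in
     (s < t) × ((t ∸ s) mod n ≡ suc (toℕ k) mod n))

IsSkolemStarter : ℕ → Pairs → Set
IsSkolemStarter n S = IsStarter n S × IsSkolem n S

CardioidalPair : ℕ → ℕ × ℕ → Set
CardioidalPair n (a , b) = ∃ λ i → (1 ≤ i × i < n) ×
  ((a ≡ i × b ≡ (2 * i) mod n) ⊎ (b ≡ i × a ≡ (2 * i) mod n))

IsCardioidalStarter : ℕ → Pairs → Set
IsCardioidalStarter n S = IsStarter n S × All (CardioidalPair n) S

-- Write n = 2q + 1. A pair {s, t} with 0 < |s − t| < n contributes the two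
-- differences |s − t| and n − |s − t|, exactly one of which is at most q.
-- In a cardioidal pair {i, 2i mod n} the gap |s − t| is i when i ≤ q and n − i
-- when i > q, so it is always the short one. Keeping the differences at most q
-- therefore shows that the gaps of a cardioidal starter are exactly 1, …, q,
-- and listing the pairs in the order of their gaps is a Skolem arrangement.
-- Order 3 gives a cardioidal starter, and {1,2}, {4,6}, {5,8}, {3,7} is a
-- Skolem starter of order 9 that is not cardioidal.
module Submission where

open import Defs
open import Data.Nat using (ℕ; zero; suc; _+_; _*_; _∸_; _≤_; _<_; _≤?_; _/_; _%_; ∣_-_∣; z≤n; s≤s)
open import Data.Nat.Properties
open import Data.Nat.DivMod using (m≡m%n+[m/n]*n; m*n/n≡m; [m+n]%n≡m%n; m<n⇒m%n≡m; n%n≡0)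
open import Data.Nat.Tactic.RingSolver using (solve-∀)
open import Data.Fin using (Fin; toℕ) renaming (zero to fzero; suc to fsuc)
open import Data.List using (List; []; _∷_; _++_; map; applyUpTo; tabulate; filter)
open import Data.List.Properties
  using (map-∘; map-cong; map-upTo; map-tabulate; tabulate-cong; filter-++; filter-all; filter-none; ++-identityʳ)
open import Data.List.Relation.Unary.All as All using (All; []; _∷_)
open import Data.List.Relation.Unary.All.Properties using (applyUpTo⁺₁) renaming (map⁺ to All-map⁺)
open import Data.List.Relation.Unary.Any using (here)
open import Data.List.Membership.Propositional.Properties using (∈-map⁻; ∈-∃++)
open import Data.List.Relation.Binary.Permutation.Propositional
  using (_↭_; ↭-refl; ↭-reflexive; ↭-sym; ↭-trans; ↭-prep; ↭-swap; module PermutationReasoning)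
open import Data.List.Relation.Binary.Permutation.Propositional.Properties
  using (All-resp-↭; ∈-resp-↭; filter-↭; shift; drop-∷; ↭-empty-inv; ++⁺; map⁺)
open import Data.List.Sort.InsertionSort ≤-decTotalOrder using (sort)
open import Data.List.Sort.InsertionSort.Properties ≤-decTotalOrder using (sort-↭)
open import Data.Product using (_×_; ∃₂; _,_; Σ; proj₁; proj₂)
open import Data.Sum using (inj₁; inj₂)
open import Function using (_∘_)
open import Relation.Nullary using (¬_; yes; no; contradiction)
open import Relation.Unary using (Pred; Decidable; ∁)
open import Relation.Binary.PropositionalEquality
  using (_≡_; refl; sym; trans; cong; cong₂; subst; module ≡-Reasoning)

private
  variable
    A B : Set

applyUpTo-+ : ∀ (f : ℕ → A) a b → applyUpTo f (a + b) ≡ applyUpTo f a ++ applyUpTo (f ∘ (a +_)) b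
applyUpTo-+ f zero    b = refl
applyUpTo-+ f (suc a) b = cong (f 0 ∷_) (applyUpTo-+ (f ∘ suc) a b)

filter-++-all-none : ∀ {p} {P : Pred A p} (P? : Decidable P) {xs ys} →
  All P xs → All (∁ P) ys → filter P? (xs ++ ys) ≡ xs
filter-++-all-none P? {xs} {ys} all none = begin
  filter P? (xs ++ ys)               ≡⟨ filter-++ P? xs ys ⟩
  filter P? xs ++ filter P? ys       ≡⟨ cong₂ _++_ (filter-all P? all) (filter-none P? none) ⟩
  xs ++ []                           ≡⟨ ++-identityʳ xs ⟩
  xs                                 ∎
  where open ≡-Reasoning

↭-∷-by-key : ∀ (key : A → B) {b bs} xs → map key xs ↭ b ∷ bs →
  Σ A λ x → Σ (List A) λ rest → (xs ↭ x ∷ rest) × key x ≡ b × map key rest ↭ bs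
↭-∷-by-key key {b} {bs} xs keys
  with x , x∈xs , b≡ ← ∈-map⁻ key (∈-resp-↭ (↭-sym keys) (here refl))
  with ys , zs , refl ← ∈-∃++ x∈xs
  = x , ys ++ zs , shift x ys zs , sym b≡ , rest-keys
  where
  rest-keys : map key (ys ++ zs) ↭ bs
  rest-keys = drop-∷ (↭-trans (↭-sym (map⁺ key (shift x ys zs)))
                              (subst (λ y → map key (ys ++ x ∷ zs) ↭ y ∷ bs) b≡ keys))

↭-tabulate-by-key : ∀ (key : A → B) (g : ℕ → B) q (xs : List A) → map key xs ↭ applyUpTo g q →
  Σ (Fin q → A) λ f → (xs ↭ tabulate f) × (∀ k → key (f k) ≡ g (toℕ k))
↭-tabulate-by-key key g zero xs keys with ↭-empty-inv keys
↭-tabulate-by-key key g zero [] keys | refl = (λ ()) , ↭-refl , (λ ())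
↭-tabulate-by-key key g (suc q) xs keys
  with x , rest , xs↭ , key-x , rest-keys ← ↭-∷-by-key key xs keys
  with f′ , rest↭ , key-f′ ← ↭-tabulate-by-key key (g ∘ suc) q rest rest-keys
  = f , ↭-trans xs↭ (↭-prep x rest↭) , key-f
  where
  f : Fin (suc q) → _
  f fzero    = x
  f (fsuc k) = f′ k
  key-f : ∀ k → key (f k) ≡ g (toℕ k)
  key-f fzero    = key-x
  key-f (fsuc k) = key-f′ k

↭-by-sort : (xs ys : List ℕ) → sort xs ≡ sort ys → xs ↭ ys
↭-by-sort xs ys eq = ↭-trans (↭-sym (sort-↭ xs)) (subst (_↭ ys) (sym eq) (sort-↭ ys))

odd⇒≡1+half+half : ∀ {n} → Odd n → n ≡ suc (half n + half n)
odd⇒≡1+half+half {zero} ()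
odd⇒≡1+half+half {n@(suc _)} odd = begin
  n                  ≡⟨ n≡1+k*2 ⟩
  suc (k * 2)        ≡⟨ cong suc k*2≡k+k ⟩
  suc (k + k)        ≡⟨ cong (λ h → suc (h + h)) half≡k ⟨
  suc (half n + half n) ∎
  where
  open ≡-Reasoning
  k = n / 2
  n≡1+k*2 : n ≡ suc (k * 2)
  n≡1+k*2 = trans (m≡m%n+[m/n]*n n 2) (cong (_+ k * 2) odd)
  k*2≡k+k : k * 2 ≡ k + k
  k*2≡k+k = trans (*-comm k 2) (cong (k +_) (+-identityʳ k))
  half≡k : half n ≡ k
  half≡k = trans (cong (_/ 2) (suc-injective n≡1+k*2)) (m*n/n≡m k 2)

[x+n∸x]mod-n≡0 : ∀ n x → (x + n ∸ x) mod n ≡ 0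
[x+n∸x]mod-n≡0 zero    x = m+n∸m≡n x 0
[x+n∸x]mod-n≡0 (suc m) x = trans (cong (_% suc m) (m+n∸m≡n x (suc m))) (n%n≡0 (suc m))

[x+d+n∸x]mod-n≡d : ∀ {n} x d → d < n → (x + d + n ∸ x) mod n ≡ d
[x+d+n∸x]mod-n≡d {suc m} x d d<n = begin
  (x + d + suc m ∸ x) % suc m   ≡⟨ cong (λ y → (y ∸ x) % suc m) (+-assoc x d (suc m)) ⟩
  (x + (d + suc m) ∸ x) % suc m ≡⟨ cong (_% suc m) (m+n∸m≡n x (d + suc m)) ⟩
  (d + suc m) % suc m           ≡⟨ [m+n]%n≡m%n d (suc m) ⟩
  d % suc m                     ≡⟨ m<n⇒m%n≡m d<n ⟩
  d                             ∎
  where open ≡-Reasoning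

[x+n∸[x+d]]mod-n≡n∸d : ∀ {n} x d → 0 < d → d < n → (x + n ∸ (x + d)) mod n ≡ n ∸ d
[x+n∸[x+d]]mod-n≡n∸d {suc m} x d 0<d d<n =
  trans (cong (_% suc m) ([m+n]∸[m+o]≡n∸o x (suc m) d)) (m<n⇒m%n≡m (∸-monoʳ-< 0<d (<⇒≤ d<n)))

gap : ℕ × ℕ → ℕ
gap (s , t) = ∣ s - t ∣

width : ℕ × ℕ → ℕ
width (s , t) = t ∸ s

pairDiffs : ℕ → ℕ × ℕ → List ℕ
pairDiffs n (s , t) = (s + n ∸ t) mod n ∷ (t + n ∸ s) mod n ∷ []

norm-ascending : ∀ {s t} → s ≤ t → norm (s , t) ≡ (s , t)
norm-ascending s≤t = cong₂ _,_ (m≤n⇒m⊓n≡m s≤t) (m≤n⇒m⊔n≡n s≤t)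

width∘norm≗gap : ∀ p → width (norm p) ≡ gap p
width∘norm≗gap (s , t) with ≤-total s t
... | inj₁ s≤t = trans (cong width (norm-ascending s≤t)) (sym (m≤n⇒∣m-n∣≡n∸m s≤t))
... | inj₂ t≤s = trans (cong₂ _∸_ (m≥n⇒m⊔n≡m t≤s) (m≥n⇒m⊓n≡n t≤s)) (sym (m≤n⇒∣n-m∣≡n∸m t≤s))

map-width-norm : ∀ S → map width (map norm S) ≡ map gap S
map-width-norm S = trans (sym (map-∘ S)) (map-cong width∘norm≗gap S)

pairDiffs-rising : ∀ {n} x d → 0 < d → d < n → pairDiffs n (x , x + d) ≡ n ∸ d ∷ d ∷ []
pairDiffs-rising x d 0<d d<n =
  cong₂ (λ a b → a ∷ b ∷ []) ([x+n∸[x+d]]mod-n≡n∸d x d 0<d d<n) ([x+d+n∸x]mod-n≡d x d d<n)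

pairDiffs-falling : ∀ {n} x d → 0 < d → d < n → pairDiffs n (x + d , x) ≡ d ∷ n ∸ d ∷ []
pairDiffs-falling x d 0<d d<n =
  cong₂ (λ a b → a ∷ b ∷ []) ([x+d+n∸x]mod-n≡d x d d<n) ([x+n∸[x+d]]mod-n≡n∸d x d 0<d d<n)

pairDiffs-↭ : ∀ n p → 0 < gap p → gap p < n → pairDiffs n p ↭ gap p ∷ n ∸ gap p ∷ []
pairDiffs-↭ n (s , t) 0<gap gap<n with ≤-total s t
... | inj₁ s≤t with d , refl ← m≤n⇒∃[o]m+o≡n s≤t rewrite ∣m-m+n∣≡n s d =
  ↭-trans (↭-reflexive (pairDiffs-rising s d 0<gap gap<n)) (↭-swap (n ∸ d) d ↭-refl)
... | inj₂ t≤s with d , refl ← m≤n⇒∃[o]m+o≡n t≤s rewrite ∣-∣-comm (t + d) t | ∣m-m+n∣≡n t d =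
  ↭-reflexive (pairDiffs-falling t d 0<gap gap<n)

gap>0 : ∀ n s t → 0 < (s + n ∸ t) mod n → 0 < gap (s , t)
gap>0 n s t 0<diff with ∣ s - t ∣ in gap≡
... | suc _ = s≤s z≤n
... | zero with refl ← ∣m-n∣≡0⇒m≡n {s} {t} gap≡ = contradiction ([x+n∸x]mod-n≡0 n s) (>⇒≢ 0<diff)

diffs-split : ∀ n S → All (λ p → pairDiffs n p ↭ gap p ∷ n ∸ gap p ∷ []) S →
  diffs n S ↭ map gap S ++ map (λ p → n ∸ gap p) S
diffs-split n []      []          = ↭-refl
diffs-split n (p ∷ S) (p↭ ∷ S↭) =
  ↭-trans (++⁺ p↭ (diffs-split n S S↭))
          (↭-prep (gap p) (↭-sym (shift (n ∸ gap p) (map gap S) (map (λ p → n ∸ gap p) S))))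

gaps-positive : ∀ n S → All (0 <_) (diffs n S) → All (λ p → 0 < gap p) S
gaps-positive n []            []             = []
gaps-positive n ((s , t) ∷ S) (0<d ∷ _ ∷ ds) = gap>0 n s t 0<d ∷ gaps-positive n S ds

nonZeroResidues-split : ∀ q →
  nonZeroResidues (suc (q + q)) ≡ applyUpTo suc q ++ applyUpTo (suc ∘ (q +_)) q
nonZeroResidues-split q = trans (map-upTo suc (q + q)) (applyUpTo-+ suc q q)

gaps↭ : ∀ q S → diffs (suc (q + q)) S ↭ nonZeroResidues (suc (q + q)) →
  All (λ p → gap p ≤ q) S → map gap S ↭ applyUpTo suc q
gaps↭ q S diffs↭ short = begin
  map gap S
    ≡⟨ filter-++-all-none (_≤? q) (All-map⁺ short) (All-map⁺ (All.map long short)) ⟨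
  filter (_≤? q) (map gap S ++ map (λ p → n ∸ gap p) S)
    ↭⟨ filter-↭ (_≤? q) split ⟨
  filter (_≤? q) (diffs n S)
    ↭⟨ filter-↭ (_≤? q) diffs↭ ⟩
  filter (_≤? q) (nonZeroResidues n)
    ≡⟨ cong (filter (_≤? q)) (nonZeroResidues-split q) ⟩
  filter (_≤? q) (applyUpTo suc q ++ applyUpTo (suc ∘ (q +_)) q)
    ≡⟨ filter-++-all-none (_≤? q) (applyUpTo⁺₁ suc q (λ i<q → i<q))
                                   (applyUpTo⁺₁ (suc ∘ (q +_)) q (λ {i} _ → <⇒≱ (s≤s (m≤m+n q i)))) ⟩
  applyUpTo suc q
    ∎
  where
  open PermutationReasoning
  n = suc (q + q)
  long : ∀ {d} → d ≤ q → ¬ (n ∸ d ≤ q)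
  long {d} d≤q = <⇒≱ (subst (_≤ n ∸ d) (m+n∸n≡m (suc q) q) (∸-monoʳ-≤ n d≤q))
  split : diffs n S ↭ map gap S ++ map (λ p → n ∸ gap p) S
  split = diffs-split n S (All.zipWith (λ {p} → pairDiffs-short {p}) (gaps-positive n S diffs-positive , short))
    where
    diffs-positive : All (0 <_) (diffs n S)
    diffs-positive = All-resp-↭ (↭-sym diffs↭) (All-map⁺ (All.universal (λ _ → s≤s z≤n) _))
    pairDiffs-short : ∀ {p} → 0 < gap p × gap p ≤ q → pairDiffs n p ↭ gap p ∷ n ∸ gap p ∷ []
    pairDiffs-short {p} (0<gap , gap≤q) = pairDiffs-↭ n p 0<gap (s≤s (≤-trans gap≤q (m≤m+n q q)))

skolem-from-gaps : ∀ n S → map gap S ↭ applyUpTo suc (half n) → IsSkolem n S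
skolem-from-gaps n S gaps↭1…q
  with f , normS↭f , width-f ← ↭-tabulate-by-key width suc (half n) (map norm S)
                                 (subst (_↭ applyUpTo suc (half n)) (sym (map-width-norm S)) gaps↭1…q)
  = f , subst (map norm S ↭_) (sym norm-f) normS↭f , λ k → ascending k , cong (_mod n) (width-f k)
  where
  ascending : ∀ k → proj₁ (f k) < proj₂ (f k)
  ascending k = m∸n≢0⇒n<m (λ width≡0 → 1+n≢0 (trans (sym (width-f k)) width≡0))
  norm-f : map norm (tabulate f) ≡ tabulate f
  norm-f = trans (map-tabulate f norm) (tabulate-cong (λ k → norm-ascending (<⇒≤ (ascending k))))

short-starter⇒skolem : ∀ {n S} → IsStarter n S → All (λ p → gap p ≤ half n) S → IsSkolem n S
short-starter⇒skolem {n} {S} (odd , _ , _ , diffs↭) short =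
  skolem-from-gaps n S (gaps↭ (half n) S (subst (λ m → diffs m S ↭ nonZeroResidues m) n≡ diffs↭) short)
  where
  n≡ : n ≡ suc (half n + half n)
  n≡ = odd⇒≡1+half+half odd

∣i-2i∣≤q : ∀ q i → i < suc (q + q) → ∣ i - (2 * i) mod suc (q + q) ∣ ≤ q
∣i-2i∣≤q q i i<n with i ≤? q
... | yes i≤q = begin
  ∣ i - (2 * i) % n ∣ ≡⟨ cong (λ j → ∣ i - j % n ∣) (cong (i +_) (+-identityʳ i)) ⟩
  ∣ i - (i + i) % n ∣ ≡⟨ cong (λ j → ∣ i - j ∣) (m<n⇒m%n≡m (s≤s (+-mono-≤ i≤q i≤q))) ⟩
  ∣ i - i + i ∣       ≡⟨ ∣m-m+n∣≡n i i ⟩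
  i                   ≤⟨ i≤q ⟩
  q                   ∎
  where
  open ≤-Reasoning
  n = suc (q + q)
... | no i≰q with r , refl ← m≤n⇒∃[o]m+o≡n (≰⇒> i≰q) = begin
  ∣ suc q + r - (2 * (suc q + r)) % n ∣         ≡⟨ cong (λ j → ∣ suc q + r - j % n ∣) (2i≡ q r) ⟩
  ∣ suc q + r - (suc (r + r) + n) % n ∣         ≡⟨ cong (λ j → ∣ suc q + r - j ∣) ([m+n]%n≡m%n (suc (r + r)) n) ⟩
  ∣ suc q + r - suc (r + r) % n ∣               ≡⟨ cong (λ j → ∣ suc q + r - j ∣) (m<n⇒m%n≡m (s≤s (+-mono-≤ r<q r≤q))) ⟩
  ∣ suc q + r - suc r + r ∣                     ≡⟨ cong (λ j → ∣ j - suc r + r ∣) (cong suc (+-comm q r)) ⟩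
  ∣ suc r + q - suc r + r ∣                     ≡⟨ ∣m+n-m+o∣≡∣n-o∣ (suc r) q r ⟩
  ∣ q - r ∣                                     ≡⟨ m≤n⇒∣n-m∣≡n∸m r≤q ⟩
  q ∸ r                                         ≤⟨ m∸n≤m q r ⟩
  q                                             ∎
  where
  open ≤-Reasoning
  n = suc (q + q)
  r<q : r < q
  r<q = +-cancelˡ-≤ q (suc r) q (subst (_≤ q + q) (sym (+-suc q r)) (≤-pred i<n))
  r≤q : r ≤ q
  r≤q = <⇒≤ r<q
  2i≡ : ∀ a b → 2 * (suc a + b) ≡ suc (b + b) + suc (a + a)
  2i≡ = solve-∀

cardioidal⇒gap≤q : ∀ q p → CardioidalPair (suc (q + q)) p → gap p ≤ q
cardioidal⇒gap≤q q _ (i , (_ , i<n) , inj₁ (refl , refl)) = ∣i-2i∣≤q q i i<n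
cardioidal⇒gap≤q q _ (i , (_ , i<n) , inj₂ (refl , refl)) = subst (_≤ q) (∣-∣-comm i _) (∣i-2i∣≤q q i i<n)

cardioidal⇒skolem : ∀ n S → IsCardioidalStarter n S → IsSkolemStarter n S
cardioidal⇒skolem n S (starter@(odd , _) , cardioidal) =
  starter , short-starter⇒skolem starter (All.map short cardioidal)
  where
  short : ∀ {p} → CardioidalPair n p → gap p ≤ half n
  short {p} = subst (λ m → CardioidalPair m p → gap p ≤ half n)
                    (sym (odd⇒≡1+half+half odd)) (cardioidal⇒gap≤q (half n) p)

cardioidal-starter-3 : IsCardioidalStarter 3 ((1 , 2) ∷ [])
cardioidal-starter-3 =
  (refl , s≤s (s≤s (s≤s z≤n)) , ↭-refl , ↭-swap 2 1 ↭-refl) ,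
  (1 , (s≤s z≤n , s≤s (s≤s z≤n)) , inj₁ (refl , refl)) ∷ []

starter-9 : Pairs
starter-9 = (1 , 2) ∷ (4 , 6) ∷ (5 , 8) ∷ (3 , 7) ∷ []

skolem-starter-9 : IsSkolemStarter 9 starter-9
skolem-starter-9 =
  (refl , s≤s (s≤s (s≤s z≤n)) , ↭-by-sort _ _ refl , ↭-by-sort _ _ refl) ,
  skolem-from-gaps 9 starter-9 ↭-refl

-- {4, 6} is not cardioidal: 2 · 4 ≡ 8 and 2 · 6 ≡ 3 modulo 9.
¬cardioidal-starter-9 : ¬ IsCardioidalStarter 9 starter-9
¬cardioidal-starter-9 (_ , _ ∷ (_ , _ , inj₁ (refl , ())) ∷ _)
¬cardioidal-starter-9 (_ , _ ∷ (_ , _ , inj₂ (refl , ())) ∷ _)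

corollary1 : ((n : ℕ) (S : Pairs) → IsCardioidalStarter n S → IsSkolemStarter n S)
    × (∃₂ λ n S → IsCardioidalStarter n S)
    × (∃₂ λ n S → IsSkolemStarter n S × ¬ IsCardioidalStarter n S)
corollary1 =
  cardioidal⇒skolem ,
  (3 , (1 , 2) ∷ [] , cardioidal-starter-3) ,
  (9 , starter-9 , skolem-starter-9 , ¬cardioidal-starter-9)
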